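{- Let $\delta\ge 2$ be an integer. For each $k\in\mathbb{N}$, let $\ell_k\ge1$ be an integer and let $\gamma_{k,0},\ldots,\gamma_{k,\ell_k-1}\ge 2$ be integers with $\prod_{j=0}^{\ell_k-1}\gamma_{k,j}=\delta$. Let $r\in[0,1)$ with greedy $\delta$-expansion $d_\delta(r)=c_0c_1c_2\cdots$ (so each $c_k\in\{0,\ldots,\delta-1\}$), and for each $k$ write uniquely \[c_k=\sum_{j=0}^{\ell_k-1}a_{k,j}\,\gamma_{k,j+1}\cdots\gamma_{k,\ell_k-1}\] with integers $0\le a_{k,j}<\gamma_{k,j}$. Consider the Cantor base $\mathbf{B}=\beta_0\beta_1\beta_2\cdots$ obtained as the concatenation $\prod_{k=0}^{+\infty}(\gamma_{k,0}\gamma_{k,1}\cdots\gamma_{k,\ell_k-1})$. Then the greedy $\mathbf{B}$-expansion of $r$ is the concatenation \[ d_{\mathbf{B}}(r)=\prod_{k=0}^{+\infty}(a_{k,0}a_{k,1}\cdots a_{k,\ell_k-1}).\]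
   Context: A Cantor real base is a sequence $\mathbf{B}=(\beta_n)_{n\in\mathbb{N}}$ of reals $>1$ with $\prod_n\beta_n=+\infty$. For $r\in[0,1]$, the greedy $\mathbf{B}$-expansion $d_{\mathbf{B}}(r)=(a_n)_{n\in\mathbb{N}}$ is defined by: having chosen $a_0,\ldots,a_{N-1}$, the digit $a_N$ is the largest integer such that $\sum_{n=0}^N a_n/(\beta_0\cdots\beta_n)\le r$. For a constant base $\delta$ this is the usual greedy $\delta$-expansion $d_\delta(r)$. Products $\prod$ of words denote concatenation. -}

module Defs where

open import Data.Nat as ℕ using (ℕ; zero; suc)
open import Data.Integer using (+_)
open import Data.Rational as ℚ using (ℚ; 0ℚ; 1ℚ; _/_)
open import Data.Vec using (Vec; []; _∷_; lookup)
open import Data.Fin using (Fin)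
open import Data.List using (List; []; _∷_)
open import Data.Product using (Σ; _×_; ∃)
open import Data.Sum using (_⊎_)
open import Relation.Nullary using (¬_)

record ℝ : Set₁ where
  field
    L U        : ℚ → Set
    L-inhabited : ∃ L
    U-inhabited : ∃ U
    L-rounded   : ∀ p → (L p → Σ ℚ λ q → p ℚ.< q × L q) × ((Σ ℚ λ q → p ℚ.< q × L q) → L p)
    U-rounded   : ∀ q → (U q → Σ ℚ λ p → p ℚ.< q × U p) × ((Σ ℚ λ p → p ℚ.< q × U p) → U q)
    disjoint    : ∀ q → ¬ (L q × U q)
    located     : ∀ p q → p ℚ.< q → L p ⊎ U q

-- q ≤ x  for a rational q and a real x (i.e. the lower cut of q is
-- contained in the lower cut of x)
_≤ᵣ_ : ℚ → ℝ → Set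
q ≤ᵣ x = ∀ p → p ℚ.< q → ℝ.L x p

_<ᵣ_ : ℝ → ℚ → Set
x <ᵣ q = ℝ.U x q

-- 1/n as a rational (only used for n ≥ 2; the value at 0 is irrelevant)
inv : ℕ → ℚ
inv zero    = 0ℚ
inv (suc n) = + 1 / suc n

fromℕ : ℕ → ℚ
fromℕ n = + n / 1

weight : (ℕ → ℕ) → ℕ → ℚ
weight β zero    = inv (β 0)
weight β (suc n) = weight β n ℚ.* inv (β (suc n))

prefix : (ℕ → ℕ) → (ℕ → ℕ) → ℕ → ℚ
prefix β a zero    = 0ℚ
prefix β a (suc N) = prefix β a N ℚ.+ fromℕ (a N) ℚ.* weight β N

-- d_B(r) = a : for every N, a N is the largest integer m with
-- Σ_{n<N} a n/(β0⋯βn) + m/(β0⋯βN) ≤ r.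
-- (Negative m never qualify as "largest" since the m = a N works and
-- a N ≥ 0, so quantifying over m : ℕ is the same.)
IsGreedyExpansion : (ℕ → ℕ) → ℝ → (ℕ → ℕ) → Set
IsGreedyExpansion β r a =
  ∀ N → ((prefix β a N ℚ.+ fromℕ (a N) ℚ.* weight β N) ≤ᵣ r)
      × (∀ m → (prefix β a N ℚ.+ fromℕ m ℚ.* weight β N) ≤ᵣ r → m ℕ.≤ a N)

const : ℕ → ℕ → ℕ
const δ _ = δ

prodV : ∀ {m} → Vec ℕ m → ℕ
prodV []       = 1
prodV (x ∷ xs) = x ℕ.* prodV xs

mixedVal : ∀ {m} → Vec ℕ m → Vec ℕ m → ℕ
mixedVal []       []       = 0
mixedVal (a ∷ as) (g ∷ gs) = a ℕ.* prodV gs ℕ.+ mixedVal as gs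

module _ {A : Set} (ℓ' : ℕ → ℕ) (w : (k : ℕ) → Vec A (suc (ℓ' k))) where
  mutual
    concatRest : ℕ → List A → ℕ → A
    concatRest k []       n       = concatBlock (suc k) (w (suc k)) n
    concatRest k (x ∷ xs) zero    = x
    concatRest k (x ∷ xs) (suc n) = concatRest k xs n

    concatBlock : (k : ℕ) → Vec A (suc (ℓ' k)) → ℕ → A
    concatBlock k (x ∷ xs) zero    = x
    concatBlock k (x ∷ xs) (suc n) = concatRest k (Data.Vec.toList xs) n

  concatWords : ℕ → A
  concatWords = concatBlock 0 (w 0)

{-# OPTIONS --safe #-}
module Submission where

-- The prefix of length n+1 of a base-β expansion is the fraction x / D with x = horner β a (n+1) its
-- mixed-radix numeral and D = prod β (n+1) = β₀⋯βₙ.  At the end of block k of the concatenation, the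
-- numeral and the denominator of B coincide with those of the δ-expansion c₀⋯c_k, since the digits a_k
-- written in the radices γ_k spell c_k.  At the end of block n, which lies beyond position n, split the
-- B-numeral after its first n+1 digits: it is x·R + T, where R is the product of the remaining bases and
-- T < R is the numeral of the remaining digits.  So the B-prefix with digit a_n is xR/(DR), at most the
-- δ-prefix (xR+T)/(DR) ≤ r.  A larger digit at n gives at least (x+1)R/(DR) ≥ (xR+T+1)/(DR), the
-- δ-prefix with last digit c_n + 1, which exceeds r because c is greedy.

open import Defs
open import Data.Nat as ℕ using (ℕ; zero; suc; _+_; _*_; _∸_; _≤_; _<_; NonZero; z≤n; s≤s; z<s)
import Data.Nat.Properties as ℕ
open import Data.Nat.Coprimality using (1-coprimeTo) renaming (sym to coprime-sym)
open import Data.Nat.Tactic.RingSolver using (solve-∀)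
import Data.Integer as ℤ
import Data.Integer.Properties as ℤ
open import Data.Rational as ℚ using (ℚ; mkℚ; 0ℚ; 1ℚ; Positive)
import Data.Rational.Properties as ℚ
open import Data.Rational.Solver using (module +-*-Solver)
open import Data.Fin as Fin using (Fin; toℕ; fromℕ<)
import Data.Fin.Properties as Fin
open import Data.Vec using (Vec; []; _∷_; lookup; toList)
open import Data.Product using (Σ; _×_; _,_)
open import Function using (_∘_)
open import Relation.Binary.PropositionalEquality
  using (_≡_; refl; sym; trans; cong; cong₂; subst; subst₂; module ≡-Reasoning)
open import Relation.Nullary using (yes; no; contradiction)

fromℕ≡mkℚ : ∀ n → fromℕ n ≡ mkℚ (ℤ.+ n) 0 (coprime-sym (1-coprimeTo n))
fromℕ≡mkℚ n = ℚ.normalize-coprime (coprime-sym (1-coprimeTo n))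

fromℕ-homo-+ : ∀ m n → fromℕ (m + n) ≡ fromℕ m ℚ.+ fromℕ n
fromℕ-homo-+ m n rewrite fromℕ≡mkℚ m | fromℕ≡mkℚ n =
  sym (cong (ℚ._/ 1) (cong₂ ℤ._+_ (ℤ.*-identityʳ (ℤ.+ m)) (ℤ.*-identityʳ (ℤ.+ n))))

fromℕ-homo-* : ∀ m n → fromℕ (m * n) ≡ fromℕ m ℚ.* fromℕ n
fromℕ-homo-* m n rewrite fromℕ≡mkℚ m | fromℕ≡mkℚ n = cong (ℚ._/ 1) (ℤ.pos-* m n)

fromℕ-mono-≤ : ∀ {m n} → m ≤ n → fromℕ m ℚ.≤ fromℕ n
fromℕ-mono-≤ {m} {n} m≤n rewrite fromℕ≡mkℚ m | fromℕ≡mkℚ n =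
  ℚ.*≤* (subst₂ ℤ._≤_ (sym (ℤ.*-identityʳ (ℤ.+ m))) (sym (ℤ.*-identityʳ (ℤ.+ n))) (ℤ.+≤+ m≤n))

fromℕ-pos : ∀ n .{{_ : NonZero n}} → Positive (fromℕ n)
fromℕ-pos (suc n) rewrite fromℕ≡mkℚ (suc n) = _

inv-*-fromℕ : ∀ n .{{_ : NonZero n}} → inv n ℚ.* fromℕ n ≡ 1ℚ
inv-*-fromℕ (suc n) rewrite fromℕ≡mkℚ (suc n) | ℚ.normalize-coprime {1} {n} (1-coprimeTo (suc n)) =
  ℚ.*-inverseˡ (mkℚ (ℤ.+ suc n) 0 (coprime-sym (1-coprimeTo (suc n))))

*-fromℕ-scale : ∀ p d x e → p ℚ.* fromℕ d ≡ fromℕ x → p ℚ.* fromℕ (d * e) ≡ fromℕ (x * e)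
*-fromℕ-scale p d x e p≡ = begin
  p ℚ.* fromℕ (d * e)          ≡⟨ cong (p ℚ.*_) (fromℕ-homo-* d e) ⟩
  p ℚ.* (fromℕ d ℚ.* fromℕ e)  ≡⟨ ℚ.*-assoc p (fromℕ d) (fromℕ e) ⟨
  (p ℚ.* fromℕ d) ℚ.* fromℕ e  ≡⟨ cong (ℚ._* fromℕ e) p≡ ⟩
  fromℕ x ℚ.* fromℕ e          ≡⟨ fromℕ-homo-* x e ⟨
  fromℕ (x * e)                ∎
  where open ≡-Reasoning

≤-viaCommonDenominator : ∀ {p q} d .{{_ : NonZero d}} {x y} →
                         p ℚ.* fromℕ d ≡ fromℕ x → q ℚ.* fromℕ d ≡ fromℕ y → x ≤ y → p ℚ.≤ q
≤-viaCommonDenominator d p≡ q≡ x≤y =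
  ℚ.*-cancelʳ-≤-pos (fromℕ d) {{fromℕ-pos d}} (subst₂ ℚ._≤_ (sym p≡) (sym q≡) (fromℕ-mono-≤ x≤y))

≤-≤ᵣ-trans : ∀ {p q r} → p ℚ.≤ q → q ≤ᵣ r → p ≤ᵣ r
≤-≤ᵣ-trans p≤q q≤r s s<p = q≤r s (ℚ.<-≤-trans s<p p≤q)

prod : (ℕ → ℕ) → ℕ → ℕ
prod β zero    = 1
prod β (suc n) = prod β n * β n

horner : (ℕ → ℕ) → (ℕ → ℕ) → ℕ → ℕ
horner β a zero    = 0
horner β a (suc n) = horner β a n * β n + a n

prod-+ : ∀ β m j → prod β (m + j) ≡ prod β m * prod (β ∘ (m +_)) j
prod-+ β m zero    rewrite ℕ.+-identityʳ m = sym (ℕ.*-identityʳ (prod β m))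
prod-+ β m (suc j) rewrite ℕ.+-suc m j =
  trans (cong (_* β (m + j)) (prod-+ β m j)) (ℕ.*-assoc (prod β m) _ (β (m + j)))

horner-+ : ∀ β a m j → horner β a (m + j) ≡ horner β a m * prod (β ∘ (m +_)) j + horner (β ∘ (m +_)) (a ∘ (m +_)) j
horner-+ β a m zero    rewrite ℕ.+-identityʳ m = sym (trans (ℕ.+-identityʳ _) (ℕ.*-identityʳ (horner β a m)))
horner-+ β a m (suc j) rewrite ℕ.+-suc m j =
  trans (cong (λ h → h * β (m + j) + a (m + j)) (horner-+ β a m j))
        (regroup (horner β a m) (prod (β ∘ (m +_)) j) (horner (β ∘ (m +_)) (a ∘ (m +_)) j) (β (m + j)) (a (m + j)))
  where
  regroup : ∀ h p t b d → (h * p + t) * b + d ≡ h * (p * b) + (t * b + d)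
  regroup = solve-∀

prod-nonZero : ∀ β → (∀ i → NonZero (β i)) → ∀ n → NonZero (prod β n)
prod-nonZero β β≢0 zero    = _
prod-nonZero β β≢0 (suc n) = ℕ.m*n≢0 (prod β n) (β n) {{prod-nonZero β β≢0 n}} {{β≢0 n}}

m*o+n<p*o : ∀ {m n o p} → n < o → m < p → m * o + n < p * o
m*o+n<p*o {m} {n} {o} {p} n<o m<p = begin-strict
  m * o + n  <⟨ ℕ.+-monoʳ-< (m * o) n<o ⟩
  m * o + o  ≡⟨ ℕ.+-comm (m * o) o ⟩
  suc m * o  ≤⟨ ℕ.*-monoˡ-≤ o m<p ⟩
  p * o      ∎
  where open ℕ.≤-Reasoning

horner-<-prod : ∀ β a → (∀ i → a i < β i) → ∀ n → horner β a n < prod β n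
horner-<-prod β a a<β zero    = z<s
horner-<-prod β a a<β (suc n) = m*o+n<p*o (a<β n) (horner-<-prod β a a<β n)

prod-lookup : ∀ β {m} (gs : Vec ℕ m) → (∀ j → β (toℕ j) ≡ lookup gs j) → prod β m ≡ prodV gs
prod-lookup β         []       β≡ = refl
prod-lookup β {suc m} (g ∷ gs) β≡ = begin
  prod β (1 + m)              ≡⟨ prod-+ β 1 m ⟩
  1 * β 0 * prod (β ∘ suc) m  ≡⟨ cong₂ _*_ (trans (ℕ.*-identityˡ (β 0)) (β≡ Fin.zero))
                                           (prod-lookup (β ∘ suc) gs (β≡ ∘ Fin.suc)) ⟩
  g * prodV gs                ∎
  where open ≡-Reasoning

horner-lookup : ∀ β a {m} (as gs : Vec ℕ m) →
                (∀ j → a (toℕ j) ≡ lookup as j) → (∀ j → β (toℕ j) ≡ lookup gs j) →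
                horner β a m ≡ mixedVal as gs
horner-lookup β a         []       []       a≡ β≡ = refl
horner-lookup β a {suc m} (x ∷ as) (g ∷ gs) a≡ β≡ = begin
  horner β a (1 + m)                                     ≡⟨ horner-+ β a 1 m ⟩
  a 0 * prod (β ∘ suc) m + horner (β ∘ suc) (a ∘ suc) m  ≡⟨ cong₂ (λ d p → d * p + horner (β ∘ suc) (a ∘ suc) m)
                                                                 (a≡ Fin.zero) (prod-lookup (β ∘ suc) gs (β≡ ∘ Fin.suc)) ⟩
  x * prodV gs + horner (β ∘ suc) (a ∘ suc) m            ≡⟨ cong (x * prodV gs +_)
                                                                 (horner-lookup (β ∘ suc) (a ∘ suc) as gs (a≡ ∘ Fin.suc) (β≡ ∘ Fin.suc)) ⟩
  x * prodV gs + mixedVal as gs                          ∎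
  where open ≡-Reasoning

prefixWith : (ℕ → ℕ) → (ℕ → ℕ) → ℕ → ℕ → ℚ
prefixWith β a n m = prefix β a n ℚ.+ fromℕ m ℚ.* weight β n

module _ (β : ℕ → ℕ) (β≢0 : ∀ i → NonZero (β i)) where
  open +-*-Solver
  open ≡-Reasoning

  weight-*-prod : ∀ n → weight β n ℚ.* fromℕ (prod β (suc n)) ≡ 1ℚ
  weight-*-prod zero = begin
    inv (β 0) ℚ.* fromℕ (1 * β 0)  ≡⟨ cong (λ b → inv (β 0) ℚ.* fromℕ b) (ℕ.*-identityˡ (β 0)) ⟩
    inv (β 0) ℚ.* fromℕ (β 0)      ≡⟨ inv-*-fromℕ (β 0) {{β≢0 0}} ⟩
    1ℚ                             ∎
  weight-*-prod (suc n) = begin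
    (w ℚ.* inv b) ℚ.* fromℕ (prod β (suc n) * b)  ≡⟨ cong ((w ℚ.* inv b) ℚ.*_) (fromℕ-homo-* (prod β (suc n)) b) ⟩
    (w ℚ.* inv b) ℚ.* (P ℚ.* fromℕ b)             ≡⟨ solve 4 (λ w i P b → (w :* i) :* (P :* b) := (w :* P) :* (i :* b))
                                                           refl w (inv b) P (fromℕ b) ⟩
    (w ℚ.* P) ℚ.* (inv b ℚ.* fromℕ b)             ≡⟨ cong₂ ℚ._*_ (weight-*-prod n) (inv-*-fromℕ b {{β≢0 (suc n)}}) ⟩
    1ℚ                                            ∎
    where
    w = weight β n
    b = β (suc n)
    P = fromℕ (prod β (suc n))

  module _ (a : ℕ → ℕ) where
    mutual
      prefix-*-prod : ∀ n → prefix β a n ℚ.* fromℕ (prod β n) ≡ fromℕ (horner β a n)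
      prefix-*-prod zero    = ℚ.*-zeroˡ (fromℕ 1)
      prefix-*-prod (suc n) = prefixWith-*-prod n (a n)

      prefixWith-*-prod : ∀ n m → prefixWith β a n m ℚ.* fromℕ (prod β (suc n)) ≡ fromℕ (horner β a n * β n + m)
      prefixWith-*-prod n m = begin
        (p ℚ.+ M ℚ.* w) ℚ.* fromℕ (prod β n * β n)   ≡⟨ cong ((p ℚ.+ M ℚ.* w) ℚ.*_) (fromℕ-homo-* (prod β n) (β n)) ⟩
        (p ℚ.+ M ℚ.* w) ℚ.* (P ℚ.* B)                ≡⟨ solve 5 (λ p M w P B → (p :+ M :* w) :* (P :* B)
                                                                          := (p :* P) :* B :+ M :* (w :* (P :* B)))
                                                              refl p M w P B ⟩
        (p ℚ.* P) ℚ.* B ℚ.+ M ℚ.* (w ℚ.* (P ℚ.* B))  ≡⟨ cong₂ (λ u v → u ℚ.* B ℚ.+ M ℚ.* v) (prefix-*-prod n) w*P*B≡1 ⟩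
        fromℕ (horner β a n) ℚ.* B ℚ.+ M ℚ.* 1ℚ      ≡⟨ cong₂ ℚ._+_ (fromℕ-homo-* (horner β a n) (β n))
                                                                    (sym (ℚ.*-identityʳ M)) ⟨
        fromℕ (horner β a n * β n) ℚ.+ M             ≡⟨ fromℕ-homo-+ (horner β a n * β n) m ⟨
        fromℕ (horner β a n * β n + m)               ∎
        where
        p = prefix β a n
        M = fromℕ m
        w = weight β n
        P = fromℕ (prod β n)
        B = fromℕ (β n)
        w*P*B≡1 : w ℚ.* (P ℚ.* B) ≡ 1ℚ
        w*P*B≡1 = trans (cong (w ℚ.*_) (sym (fromℕ-homo-* (prod β n) (β n)))) (weight-*-prod n)

GreedyDigit : (ℕ → ℕ) → ℝ → (ℕ → ℕ) → ℕ → Set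
GreedyDigit β r a n = (prefixWith β a n (a n) ≤ᵣ r) × (∀ m → prefixWith β a n m ≤ᵣ r → m ≤ a n)

greedyDigit-refine : ∀ {β a β′ c r n k N} → (∀ i → a i < β i) → (∀ i → NonZero (β′ i)) → suc n ≤ N →
                     horner β a N ≡ horner β′ c (suc k) → prod β N ≡ prod β′ (suc k) →
                     GreedyDigit β′ r c k → GreedyDigit β r a n
greedyDigit-refine {β} {a} {β′} {c} {r} {n} {k} {N} a<β β′≢0 n<N h≡ p≡ (c-fits , c-max)
  with N ∸ suc n | ℕ.m+[n∸m]≡n n<N
... | j | refl = a-fits , a-max
  where
  β≢0 : ∀ i → NonZero (β i)
  β≢0 i = ℕ.>-nonZero (ℕ.≤-trans (s≤s z≤n) (a<β i))
  x = horner β a (suc n)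
  D = prod β (suc n)
  R = prod (β ∘ (suc n +_)) j
  T = horner (β ∘ (suc n +_)) (a ∘ (suc n +_)) j
  T<R : T < R
  T<R = horner-<-prod _ _ (a<β ∘ (suc n +_)) j
  c-numerator : horner β′ c (suc k) ≡ x * R + T
  c-numerator = trans (sym h≡) (horner-+ β a (suc n) j)
  c-denominator : prod β′ (suc k) ≡ D * R
  c-denominator = trans (sym p≡) (prod-+ β (suc n) j)
  DR≢0 : NonZero (D * R)
  DR≢0 = subst NonZero (prod-+ β (suc n) j) (prod-nonZero β β≢0 (suc n + j))
  a-over-DR : ∀ m → prefixWith β a n m ℚ.* fromℕ (D * R) ≡ fromℕ ((horner β a n * β n + m) * R)
  a-over-DR m = *-fromℕ-scale (prefixWith β a n m) D (horner β a n * β n + m) R (prefixWith-*-prod β β≢0 a n m)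
  c-over-DR : ∀ m → prefixWith β′ c k m ℚ.* fromℕ (D * R) ≡ fromℕ (horner β′ c k * β′ k + m)
  c-over-DR m = trans (cong (λ d → prefixWith β′ c k m ℚ.* fromℕ d) (sym c-denominator))
                      (prefixWith-*-prod β′ β′≢0 c k m)
  a-fits : prefixWith β a n (a n) ≤ᵣ r
  a-fits = ≤-≤ᵣ-trans {r = r}
             (≤-viaCommonDenominator (D * R) {{DR≢0}} (a-over-DR (a n)) (c-over-DR (c k))
                                     (subst (x * R ≤_) (sym c-numerator) (ℕ.m≤m+n (x * R) T)))
             c-fits
  a-max : ∀ m → prefixWith β a n m ≤ᵣ r → m ≤ a n
  a-max m m-fits with a n ℕ.<? m
  ... | no  an≮m = ℕ.≮⇒≥ an≮m
  ... | yes an<m = contradiction (c-max (suc (c k)) c+1-fits) (ℕ.n≮n (c k))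
    where
    carry : horner β′ c k * β′ k + suc (c k) ≤ (horner β a n * β n + m) * R
    carry = begin
      horner β′ c k * β′ k + suc (c k)  ≡⟨ ℕ.+-suc (horner β′ c k * β′ k) (c k) ⟩
      suc (horner β′ c (suc k))         ≡⟨ cong suc c-numerator ⟩
      suc (x * R + T)                   ≤⟨ m*o+n<p*o T<R (ℕ.+-monoʳ-< (horner β a n * β n) an<m) ⟩
      (horner β a n * β n + m) * R      ∎
      where open ℕ.≤-Reasoning
    c+1-fits : prefixWith β′ c k (suc (c k)) ≤ᵣ r
    c+1-fits = ≤-≤ᵣ-trans {r = r}
                 (≤-viaCommonDenominator (D * R) {{DR≢0}} (c-over-DR (suc (c k))) (a-over-DR m) carry)
                 m-fits

blockStart : (ℕ → ℕ) → ℕ → ℕ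
blockStart ℓ' zero    = 0
blockStart ℓ' (suc k) = blockStart ℓ' k + suc (ℓ' k)

n<blockStart-suc : ∀ ℓ' n → n < blockStart ℓ' (suc n)
n<blockStart-suc ℓ' zero    = z<s
n<blockStart-suc ℓ' (suc n) = ℕ.≤-trans (s≤s (n<blockStart-suc ℓ' n)) (ℕ.m<m+n (blockStart ℓ' (suc n)) z<s)

blockStart-decompose : ∀ ℓ' n → Σ ℕ λ k → Σ (Fin (suc (ℓ' k))) λ j → n ≡ blockStart ℓ' k + toℕ j
blockStart-decompose ℓ' zero = 0 , Fin.zero , refl
blockStart-decompose ℓ' (suc n) with blockStart-decompose ℓ' n
... | k , j , refl with suc (toℕ j) ℕ.<? suc (ℓ' k)
...   | yes j+1<ℓ = k , fromℕ< j+1<ℓ ,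
                    sym (trans (cong (blockStart ℓ' k +_) (Fin.toℕ-fromℕ< j+1<ℓ)) (ℕ.+-suc _ (toℕ j)))
...   | no  j+1≮ℓ = suc k , Fin.zero ,
                    sym (trans (ℕ.+-identityʳ _) (trans (cong (blockStart ℓ' k +_) (sym j+1≡ℓ)) (ℕ.+-suc _ (toℕ j))))
  where
  j+1≡ℓ : suc (toℕ j) ≡ suc (ℓ' k)
  j+1≡ℓ = ℕ.≤-antisym (Fin.toℕ<n j) (ℕ.≮⇒≥ j+1≮ℓ)

module _ {A : Set} (ℓ' : ℕ → ℕ) (w : (k : ℕ) → Vec A (suc (ℓ' k))) where

  concatRest-+ : ∀ k {m} (xs : Vec A m) n →
                 concatRest ℓ' w k (toList xs) (m + n) ≡ concatBlock ℓ' w (suc k) (w (suc k)) n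
  concatRest-+ k []       n = refl
  concatRest-+ k (x ∷ xs) n = concatRest-+ k xs n

  concatBlock-+ : ∀ k (v : Vec A (suc (ℓ' k))) n →
                  concatBlock ℓ' w k v (suc (ℓ' k) + n) ≡ concatBlock ℓ' w (suc k) (w (suc k)) n
  concatBlock-+ k (x ∷ xs) n = concatRest-+ k xs n

  concatWords-blockStart : ∀ k n → concatWords ℓ' w (blockStart ℓ' k + n) ≡ concatBlock ℓ' w k (w k) n
  concatWords-blockStart zero    n = refl
  concatWords-blockStart (suc k) n = begin
    concatWords ℓ' w (blockStart ℓ' k + suc (ℓ' k) + n)    ≡⟨ cong (concatWords ℓ' w) (ℕ.+-assoc (blockStart ℓ' k) (suc (ℓ' k)) n) ⟩
    concatWords ℓ' w (blockStart ℓ' k + (suc (ℓ' k) + n))  ≡⟨ concatWords-blockStart k (suc (ℓ' k) + n) ⟩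
    concatBlock ℓ' w k (w k) (suc (ℓ' k) + n)              ≡⟨ concatBlock-+ k (w k) n ⟩
    concatBlock ℓ' w (suc k) (w (suc k)) n                 ∎
    where open ≡-Reasoning

  concatRest-lookup : ∀ k {m} (xs : Vec A m) j → concatRest ℓ' w k (toList xs) (toℕ j) ≡ lookup xs j
  concatRest-lookup k (x ∷ xs) Fin.zero    = refl
  concatRest-lookup k (x ∷ xs) (Fin.suc j) = concatRest-lookup k xs j

  concatBlock-lookup : ∀ k (v : Vec A (suc (ℓ' k))) j → concatBlock ℓ' w k v (toℕ j) ≡ lookup v j
  concatBlock-lookup k (x ∷ xs) Fin.zero    = refl
  concatBlock-lookup k (x ∷ xs) (Fin.suc j) = concatRest-lookup k xs j

  concatWords-lookup : ∀ k j → concatWords ℓ' w (blockStart ℓ' k + toℕ j) ≡ lookup (w k) j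
  concatWords-lookup k j = trans (concatWords-blockStart k (toℕ j)) (concatBlock-lookup k (w k) j)

concatWords-pointwise : ∀ {A B : Set} (_∼_ : A → B → Set) ℓ' →
                        (u : (k : ℕ) → Vec A (suc (ℓ' k))) (v : (k : ℕ) → Vec B (suc (ℓ' k))) →
                        (∀ k j → lookup (u k) j ∼ lookup (v k) j) → ∀ n → concatWords ℓ' u n ∼ concatWords ℓ' v n
concatWords-pointwise _∼_ ℓ' u v u∼v n with blockStart-decompose ℓ' n
... | k , j , refl = subst₂ _∼_ (sym (concatWords-lookup ℓ' u k j)) (sym (concatWords-lookup ℓ' v k j)) (u∼v k j)

module _ (ℓ' : ℕ → ℕ) (γ : (k : ℕ) → Vec ℕ (suc (ℓ' k))) where
  private
    B = concatWords ℓ' γ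

  prod-blockStart-suc : ∀ k → prod B (blockStart ℓ' (suc k)) ≡ prod B (blockStart ℓ' k) * prodV (γ k)
  prod-blockStart-suc k =
    trans (prod-+ B (blockStart ℓ' k) (suc (ℓ' k)))
          (cong (prod B (blockStart ℓ' k) *_) (prod-lookup _ (γ k) (concatWords-lookup ℓ' γ k)))

  prod-blockStart : ∀ {δ} → (∀ k → prodV (γ k) ≡ δ) → ∀ k → prod B (blockStart ℓ' k) ≡ prod (const δ) k
  prod-blockStart ∏γ≡δ zero    = refl
  prod-blockStart ∏γ≡δ (suc k) = trans (prod-blockStart-suc k) (cong₂ _*_ (prod-blockStart ∏γ≡δ k) (∏γ≡δ k))

  module _ (a : (k : ℕ) → Vec ℕ (suc (ℓ' k))) where
    private
      A = concatWords ℓ' a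

    horner-blockStart-suc : ∀ k → horner B A (blockStart ℓ' (suc k))
                                ≡ horner B A (blockStart ℓ' k) * prodV (γ k) + mixedVal (a k) (γ k)
    horner-blockStart-suc k =
      trans (horner-+ B A (blockStart ℓ' k) (suc (ℓ' k)))
            (cong₂ (λ p t → horner B A (blockStart ℓ' k) * p + t)
                   (prod-lookup _ (γ k) (concatWords-lookup ℓ' γ k))
                   (horner-lookup _ _ (a k) (γ k) (concatWords-lookup ℓ' a k) (concatWords-lookup ℓ' γ k)))

    horner-blockStart : ∀ {δ c} → (∀ k → prodV (γ k) ≡ δ) → (∀ k → c k ≡ mixedVal (a k) (γ k)) →
                        ∀ k → horner B A (blockStart ℓ' k) ≡ horner (const δ) c k
    horner-blockStart ∏γ≡δ c≡ zero    = refl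
    horner-blockStart ∏γ≡δ c≡ (suc k) =
      trans (horner-blockStart-suc k)
            (cong₂ _+_ (cong₂ _*_ (horner-blockStart ∏γ≡δ c≡ k) (∏γ≡δ k)) (sym (c≡ k)))

theorem2p4 : (δ : ℕ) → 2 ≤ δ →
    (ℓ' : ℕ → ℕ) → (γ : (k : ℕ) → Vec ℕ (suc (ℓ' k))) →
    (∀ k (j : Fin (suc (ℓ' k))) → 2 ≤ lookup (γ k) j) →
    (∀ k → prodV (γ k) ≡ δ) →
    (r : ℝ) → 0ℚ ≤ᵣ r → r <ᵣ 1ℚ →
    (c : ℕ → ℕ) → IsGreedyExpansion (const δ) r c →
    (a : (k : ℕ) → Vec ℕ (suc (ℓ' k))) →
    (∀ k (j : Fin (suc (ℓ' k))) → lookup (a k) j < lookup (γ k) j) →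
    (∀ k → c k ≡ mixedVal (a k) (γ k)) →
    IsGreedyExpansion (concatWords ℓ' γ) r (concatWords ℓ' a)
theorem2p4 δ 2≤δ ℓ' γ _ ∏γ≡δ r _ _ c c-greedy a a<γ c≡ n =
  greedyDigit-refine {c = c} {r = r} {k = n}
    (concatWords-pointwise _<_ ℓ' a γ a<γ) (λ _ → δ≢0) (n<blockStart-suc ℓ' n)
    (horner-blockStart ℓ' γ a ∏γ≡δ c≡ (suc n)) (prod-blockStart ℓ' γ ∏γ≡δ (suc n))
    (c-greedy n)
  where
  δ≢0 : NonZero δ
  δ≢0 = ℕ.>-nonZero (ℕ.≤-trans (s≤s z≤n) 2≤δ)
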